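{- If $Y$ is a graph that is a generalized truncation of some multigraph and $\mathrm{src}(Y)$ consists of a single multigraph $X$, then $X$ is a complete multigraph, i.e. every pair of distinct vertices of $X$ is joined by at least one edge.
   Context: A multigraph may have multiple edges but no loops; a graph has neither loops nor multiple edges. Multigraphs from which generalized truncations are formed are assumed to have no isolated vertices. Generalized truncation: let $X$ be a multigraph. Take a matching $M_0$ with $|M_0|=|E(X)|$ (on $2|E(X)|$ new vertices) and a bijection $F:E(X)\to M_0$; for each edge $e$ of $X$ with ends $u,v$, label one end of $F(e)$ by $u$ and the other by $v$. For $v\in V(X)$, the cluster $\mathrm{cl}(v)$ is the set of vertices labelled $v$; insert an arbitrary graph $\mathrm{con}(v)$ on $\mathrm{cl}(v)$. The graph $F(M_0)\cup\bigcup_v\mathrm{con}(v)$, and any graph isomorphic to it, is a generalized truncation of $X$. For a graph $Y$, the source $\mathrm{src}(Y)$ is the set of multigraphs $X$ (without loops, considered up to isomorphism) such that $Y$ is a generalized truncation of $X$. -}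

module Defs where

open import Data.Nat using (ℕ)
open import Data.Fin using (Fin)
open import Data.Bool using (Bool; true; false)
open import Data.Product using (Σ; Σ-syntax; ∃; ∃-syntax; _×_; _,_; proj₁; proj₂)
open import Data.Sum using (_⊎_)
open import Relation.Nullary using (¬_)
open import Relation.Binary.PropositionalEquality using (_≡_; _≢_)
open import Function.Bundles using (_↔_; Inverse; _⇔_)

record Graph (V : Set) : Set₁ where
  field
    Adj     : V → V → Set
    sym     : ∀ {x y} → Adj x y → Adj y x
    irrefl  : ∀ {x} → ¬ Adj x x
open Graph public

RelIso : {V W : Set} → (V → V → Set) → (W → W → Set) → Set
RelIso {V} {W} R S =
  Σ[ f ∈ V ↔ W ] (∀ x y → R x y ⇔ S (Inverse.to f x) (Inverse.to f y))

-- Finite loopless multigraphs with vertex set Fin n and edge set Fin m;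
-- edge e has ends (ends e) (an unordered pair, stored as an ordered pair).

record Multigraph : Set where
  field
    n        : ℕ
    m        : ℕ
    ends     : Fin m → Fin n × Fin n
    noLoop   : ∀ e → proj₁ (ends e) ≢ proj₂ (ends e)
    noIsol   : ∀ v → ∃[ e ] (proj₁ (ends e) ≡ v ⊎ proj₂ (ends e) ≡ v)
open Multigraph public

Joins : (X : Multigraph) → Fin (m X) → Fin (n X) → Fin (n X) → Set
Joins X e u v = (ends X e ≡ (u , v)) ⊎ (ends X e ≡ (v , u))

MIso : Multigraph → Multigraph → Set
MIso X X' =
  Σ[ σ ∈ Fin (n X) ↔ Fin (n X') ] Σ[ τ ∈ Fin (m X) ↔ Fin (m X') ]
    (∀ e → Joins X' (Inverse.to τ e)
                    (Inverse.to σ (proj₁ (ends X e)))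
                    (Inverse.to σ (proj₂ (ends X e))))

IsCompleteMultigraph : Multigraph → Set
IsCompleteMultigraph X = ∀ (u v : Fin (n X)) → u ≢ v → ∃[ e ] Joins X e u v

-- Generalized truncation.
-- New vertices: Fin m × Bool; F(e) is the matching edge {(e,false),(e,true)};
-- (e,false) is labelled by the first end of e, (e,true) by the second.

NewVertex : Multigraph → Set
NewVertex X = Fin (m X) × Bool

label : (X : Multigraph) → NewVertex X → Fin (n X)
label X (e , false) = proj₁ (ends X e)
label X (e , true)  = proj₂ (ends X e)

Cluster : (X : Multigraph) → Fin (n X) → Set
Cluster X v = Σ[ x ∈ NewVertex X ] label X x ≡ v

Matched : (X : Multigraph) → NewVertex X → NewVertex X → Set
Matched X x y = (proj₁ x ≡ proj₁ y) × (proj₂ x ≢ proj₂ y)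

-- adjacency of F(M₀) ∪ ⋃_v con(v), for a choice of graphs con(v) on cl(v)
TruncAdj : (X : Multigraph) → (con : (v : Fin (n X)) → Graph (Cluster X v)) →
           NewVertex X → NewVertex X → Set
TruncAdj X con x y =
  Matched X x y ⊎
  (Σ[ v ∈ Fin (n X) ] Σ[ p ∈ label X x ≡ v ] Σ[ q ∈ label X y ≡ v ]
     Adj (con v) (x , p) (y , q))

IsGenTrunc : {k : ℕ} → Graph (Fin k) → Multigraph → Set₁
IsGenTrunc Y X =
  Σ[ con ∈ ((v : Fin (n X)) → Graph (Cluster X v)) ] RelIso (Adj Y) (TruncAdj X con)

-- If u and v are distinct vertices of X joined by no edge, identifying u and v
-- gives a loopless multigraph X′ with one vertex fewer and the same edges.  The
-- matching of a generalized truncation of X is then also a matching for X′, and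
-- the cluster of the merged vertex is cl(u) ∪ cl(v), carrying con(u) ⊔ con(v);
-- so Y is a generalized truncation of X′ as well.  Uniqueness of the source
-- forces X′ ≅ X, which is impossible by counting vertices.
module Submission where

open import Defs hiding (sym)
open import Data.Nat using (ℕ; zero; suc; pred)
open import Data.Nat.Properties using (1+n≢n)
open import Data.Fin using (Fin; punchIn; punchOut)
open import Data.Fin.Properties using (_≟_; any?; punchOut-injective; punchOut-cong; punchOut-punchIn; punchInᵢ≢i)
open import Data.Fin.Permutation using (↔⇒≡)
open import Data.Bool using (false; true)
open import Data.Product using (Σ-syntax; ∃-syntax; _,_; proj₁; proj₂; map)
open import Data.Product.Properties using (≡-dec)
import Data.Sum as Sum
open import Data.Sum using (_⊎_; inj₁; inj₂)
open import Relation.Nullary using (¬_; Dec; yes; no; contradiction)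
open import Relation.Nullary.Decidable using (_⊎-dec_)
open import Relation.Binary.PropositionalEquality using (_≡_; _≢_; refl; sym; trans; cong; cong₂; subst)
open import Function using (_∘_)
open import Function.Bundles using (_⇔_; mk⇔; Inverse)
open import Function.Construct.Composition using (_⇔-∘_)
open import Axiom.UniquenessOfIdentityProofs using (module Decidable⇒UIP)

RelIso-respʳ : {V W : Set} {R : V → V → Set} {S S′ : W → W → Set} →
               (∀ x y → S x y ⇔ S′ x y) → RelIso R S → RelIso R S′
RelIso-respʳ S⇔S′ (f , R⇔S) =
  f , λ x y → S⇔S′ (Inverse.to f x) (Inverse.to f y) ⇔-∘ R⇔S x y

MIso⇒vertexCount≡ : {X X′ : Multigraph} → MIso X X′ → n X ≡ n X′
MIso⇒vertexCount≡ (σ , _) = ↔⇒≡ σ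

pred≢ : {N : ℕ} → Fin N → pred N ≢ N
pred≢ {suc N} _ = 1+n≢n ∘ sym

joins? : (X : Multigraph) (e : Fin (m X)) (u v : Fin (n X)) → Dec (Joins X e u v)
joins? X e u v = (ends X e ≟₂ (u , v)) ⊎-dec (ends X e ≟₂ (v , u))
  where _≟₂_ = ≡-dec _≟_ _≟_

merge : {N : ℕ} {u v : Fin N} → u ≢ v → Fin N → Fin (pred N)
merge {zero} {()}
merge {suc N} {u} {v} u≢v x with v ≟ x
... | yes _   = punchOut (u≢v ∘ sym)
... | no v≢x = punchOut v≢x

merge-identifies : {N : ℕ} {u v : Fin N} (u≢v : u ≢ v) {x y : Fin N} →
                   merge u≢v x ≡ merge u≢v y →
                   x ≡ y ⊎ ((x , y) ≡ (u , v) ⊎ (x , y) ≡ (v , u))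
merge-identifies {zero} {()}
merge-identifies {suc N} {u} {v} u≢v {x} {y} eq with v ≟ x | v ≟ y
... | yes v≡x | yes v≡y = inj₁ (trans (sym v≡x) v≡y)
... | yes v≡x | no v≢y  = inj₂ (inj₂ (cong₂ _,_ (sym v≡x) (sym (punchOut-injective (u≢v ∘ sym) v≢y eq))))
... | no v≢x  | yes v≡y = inj₂ (inj₁ (cong₂ _,_ (punchOut-injective v≢x (u≢v ∘ sym) eq) (sym v≡y)))
... | no v≢x  | no v≢y  = inj₁ (punchOut-injective v≢x v≢y eq)

merge-surjective : {N : ℕ} {u v : Fin N} (u≢v : u ≢ v) → ∀ w → ∃[ x ] merge u≢v x ≡ w
merge-surjective {zero} {()}
merge-surjective {suc N} {u} {v} u≢v w = punchIn v w , merge-punchIn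
  where
  merge-punchIn : merge u≢v (punchIn v w) ≡ w
  merge-punchIn with v ≟ punchIn v w
  ... | yes v≡punchIn = contradiction (sym v≡punchIn) (punchInᵢ≢i v w)
  ... | no _          = trans (punchOut-cong v refl) (punchOut-punchIn v)

ClusterAdj : (X : Multigraph) → ((v : Fin (n X)) → Graph (Cluster X v)) →
             NewVertex X → NewVertex X → Set
ClusterAdj X con x y =
  Σ[ v ∈ Fin (n X) ] Σ[ p ∈ label X x ≡ v ] Σ[ q ∈ label X y ≡ v ]
    Adj (con v) (x , p) (y , q)

module Quotient (X : Multigraph) {N : ℕ} (f : Fin (n X) → Fin N)
                (f-noLoop : ∀ e → f (proj₁ (ends X e)) ≢ f (proj₂ (ends X e)))
                (f-surjective : ∀ w → ∃[ v ] f v ≡ w) where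

  quotient : Multigraph
  quotient = record
    { n      = N
    ; m      = m X
    ; ends   = map f f ∘ ends X
    ; noLoop = f-noLoop
    ; noIsol = λ w → let (v , fv≡w) = f-surjective w
                         (e , incident) = noIsol X v
                     in e , Sum.map (λ p → trans (cong f p) fv≡w)
                                    (λ p → trans (cong f p) fv≡w) incident
    }

  label-quotient : ∀ x → label quotient x ≡ f (label X x)
  label-quotient (_ , false) = refl
  label-quotient (_ , true)  = refl

  quotientCon : ((v : Fin (n X)) → Graph (Cluster X v)) →
                (w : Fin N) → Graph (Cluster quotient w)
  quotientCon con w = record
    { Adj    = λ (x , _) (y , _) → ClusterAdj X con x y
    ; sym    = λ (v , p , q , xy) → v , q , p , Graph.sym (con v) xy
    ; irrefl = λ {(x , _)} (v , p , q , xx) →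
        Graph.irrefl (con v)
          (subst (λ q → Adj (con v) (x , p) (x , q)) (Decidable⇒UIP.≡-irrelevant _≟_ q p) xx)
    }

  TruncAdj-quotient : (con : (v : Fin (n X)) → Graph (Cluster X v)) →
                      ∀ x y → TruncAdj X con x y ⇔ TruncAdj quotient (quotientCon con) x y
  TruncAdj-quotient con x y = mk⇔ to from
    where
    to : TruncAdj X con x y → TruncAdj quotient (quotientCon con) x y
    to (inj₁ matched)            = inj₁ matched
    to (inj₂ xy@(v , p , q , _)) =
      inj₂ (f v , trans (label-quotient x) (cong f p) , trans (label-quotient y) (cong f q) , xy)

    from : TruncAdj quotient (quotientCon con) x y → TruncAdj X con x y
    from (inj₁ matched)          = inj₁ matched
    from (inj₂ (_ , _ , _ , xy)) = inj₂ xy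

  isGenTrunc-quotient : {k : ℕ} {Y : Graph (Fin k)} → IsGenTrunc Y X → IsGenTrunc Y quotient
  isGenTrunc-quotient (con , iso) = quotientCon con , RelIso-respʳ (TruncAdj-quotient con) iso

module Contraction (X : Multigraph) {u v : Fin (n X)} (u≢v : u ≢ v)
                   (notJoined : ¬ (∃[ e ] Joins X e u v)) where

  merge-noLoop : ∀ e → merge u≢v (proj₁ (ends X e)) ≢ merge u≢v (proj₂ (ends X e))
  merge-noLoop e eq with merge-identifies u≢v eq
  ... | inj₁ loop   = noLoop X e loop
  ... | inj₂ joined = notJoined (e , joined)

  open Quotient X (merge u≢v) merge-noLoop (merge-surjective u≢v) public

lemma2p7 : (k : ℕ) (Y : Graph (Fin k)) (X : Multigraph) →
    IsGenTrunc Y X →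
    ((X' : Multigraph) → IsGenTrunc Y X' → MIso X' X) →
    IsCompleteMultigraph X
lemma2p7 k Y X gt uniq u v u≢v with any? (λ e → joins? X e u v)
... | yes joined   = joined
... | no notJoined = contradiction n[quotient]≡n[X] (pred≢ u)
  where
  open Contraction X u≢v notJoined
  n[quotient]≡n[X] : pred (n X) ≡ n X
  n[quotient]≡n[X] = MIso⇒vertexCount≡ {quotient} {X} (uniq quotient (isGenTrunc-quotient {Y = Y} gt))
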